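{- For every natural number $n\geq 2$, \[ \varphi^2(n)\psi^2(n)+\varphi^2(n)\sigma^2(n)+\sigma^2(n)\psi^2(n)\geq 3n^4+4n^3+2n^2+4n+3. \]
   Context: For a natural number $n$, $\varphi(n)$ is Euler's totient function (the number of positive integers not exceeding $n$ that are coprime to $n$). For $n=p_1^{a_1}\cdots p_k^{a_k}$ (distinct primes $p_i$, $a_i\geq1$), the Dedekind function is $\psi(n)=\prod_{i=1}^k p_i^{a_i-1}(p_i+1)$, with $\psi(1)=1$. $\sigma(n)$ denotes the sum of the positive divisors of $n$. -}

module Defs where

open import Data.Nat using (ℕ; zero; suc; _+_; _*_; _∸_; _^_)
open import Data.Nat.Divisibility using (_∣_; _∣?_)
open import Data.Nat.Coprimality using (coprime?)
open import Data.Nat.Primality using (prime?)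
open import Data.List using (List; filter; map; upTo; length; foldr)
open import Data.Nat.ListAction using (sum; product)
open import Data.Bool using (if_then_else_)
open import Relation.Nullary.Decidable using (does)

range1 : ℕ → List ℕ
range1 n = map suc (upTo n)

φ : ℕ → ℕ
φ n = length (filter (λ k → coprime? k n) (range1 n))

σ : ℕ → ℕ
σ n = sum (filter (λ d → d ∣? n) (range1 n))

-- p-adic valuation of n (for n ≥ 1, p ≥ 2): the largest a ≤ n with p ^ a ∣ n.
-- Since p ^ a ≥ 2 ^ a > a, the exponent of p in n is always ≤ n, so the bound is harmless.
val : ℕ → ℕ → ℕ
val p n = foldr step 0 (range1 n)
  where
  -- range1 n is increasing, so folding from the right keeps the largest valid a
  step : ℕ → ℕ → ℕ
  step a acc = if does (acc Data.Nat.≟ 0) then (if does ((p ^ a) ∣? n) then a else 0) else acc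
    where import Data.Nat

primeDivisors : ℕ → List ℕ
primeDivisors n = filter (λ p → p ∣? n) (filter prime? (range1 n))

ψ : ℕ → ℕ
ψ n = product (map (λ p → p ^ (val p n ∸ 1) * (p + 1)) (primeDivisors n))

-- Write R = Σ n / p over the primes p ∣ n. Every k ≤ n that is not coprime to n is a multiple of
-- some prime p ∣ n, so φ n ≥ n − R. The divisor n and the cofactors n / p are distinct, so σ n ≥ n + R.
-- From the factorisation, ψ n = n ∏ (1 + 1/p) ≥ n (1 + Σ 1/p) = n + R. Hence, when R ≤ n, the sum
-- φ²ψ² + φ²σ² + σ²ψ² is at least 2 (n − R)² (n + R)² + (n + R)⁴ = 3n⁴ + 4n³R + 2n²R² + 4nR³ + 3R⁴,
-- which increases with R and is the claimed bound at R = 1; when R > n, already σ²ψ² ≥ (2n)⁴ suffices.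
-- R ≥ 1 because n ≥ 2 has a prime divisor.
module Submission where

open import Data.Bool using (if_then_else_)
open import Data.Empty using (⊥-elim)
open import Data.List using (List; []; _∷_; _++_; [_]; map; filter; length; upTo; foldr)
open import Data.List.Membership.Propositional using (_∈_)
open import Data.List.Membership.Propositional.Properties using (∈-map⁺; ∈-map⁻; ∈-upTo⁺; ∈-filter⁺; ∈-filter⁻)
open import Data.List.Properties
  using (map-++; upTo-∷ʳ; filter-++; length-++; foldr-++; filter-none; filter-accept; filter-reject;
         map-cong-local; length-map; length-upTo)
open import Data.List.Relation.Unary.All using (All; []; _∷_)
import Data.List.Relation.Unary.All as All
import Data.List.Relation.Unary.All.Properties as All
open import Data.List.Relation.Unary.AllPairs using ([]; _∷_)
open import Data.List.Relation.Unary.Any using (Any; here; there; _─_)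
import Data.List.Relation.Unary.Any as Any
open import Data.List.Relation.Unary.Unique.Propositional using (Unique)
import Data.List.Relation.Unary.Unique.Propositional.Properties as Unique
open import Data.Nat
open import Data.Nat.Coprimality using (Coprime; coprime?; gcd≡1⇒coprime)
open import Data.Nat.Divisibility
open import Data.Nat.GCD using (gcd; gcd[m,n]∣m; gcd[m,n]∣n)
open import Data.Nat.ListAction using (sum; product)
open import Data.Nat.Primality
open import Data.Nat.Primality.Factorisation using (factorise)
open import Data.Nat.Properties
open import Algebra.Properties.CommutativeSemigroup +-commutativeSemigroup using (x∙yz≈y∙xz)
import Algebra.Properties.CommutativeSemigroup *-commutativeSemigroup as *-Props
open import Data.Nat.Solver using (module +-*-Solver)
open +-*-Solver using (solve; _:=_; _:+_; _:*_; _:^_; con)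
open import Data.Nat.Tactic.RingSolver using (solve-∀)
open import Data.Product using (_×_; _,_; proj₁; proj₂; ∃-syntax)
open import Data.Sum using (_⊎_; inj₁; inj₂)
open import Function using (_∘_; case_of_)
open import Relation.Binary.PropositionalEquality hiding ([_])
open import Relation.Nullary using (¬_; yes; no; does; contradiction)
open import Relation.Unary using (Pred; Decidable; ∁; _∩_)
open import Relation.Unary.Properties using (_∩?_; ∁?)

open import Defs

range1-∷ʳ : ∀ n → range1 (suc n) ≡ range1 n ++ [ suc n ]
range1-∷ʳ n = trans (cong (map suc) (sym (upTo-∷ʳ n))) (map-++ suc (upTo n) [ n ])

∈-range1⁺ : ∀ {n x} → 1 ≤ x → x ≤ n → x ∈ range1 n
∈-range1⁺ {x = suc x} _ x<n = ∈-map⁺ suc (∈-upTo⁺ x<n)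

range1-unique : ∀ n → Unique (range1 n)
range1-unique n = Unique.map⁺ suc-injective (Unique.upTo⁺ n)

length-range1 : ∀ n → length (range1 n) ≡ n
length-range1 n = trans (length-map suc (upTo n)) (length-upTo n)

sum-─ : ∀ {x xs} (x∈xs : x ∈ xs) → sum xs ≡ x + sum (xs ─ x∈xs)
sum-─ (here refl) = refl
sum-─ {x} {y ∷ xs} (there x∈xs) = begin
  y + sum xs                 ≡⟨ cong (y +_) (sum-─ x∈xs) ⟩
  y + (x + sum (xs ─ x∈xs))  ≡⟨ x∙yz≈y∙xz y x _ ⟩
  x + (y + sum (xs ─ x∈xs))  ∎
  where open ≡-Reasoning

∈-─ : ∀ {a} {A : Set a} {x z : A} {xs} (x∈xs : x ∈ xs) → z ∈ xs → z ≢ x → z ∈ (xs ─ x∈xs)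
∈-─ (here refl) (here refl)  z≢x = ⊥-elim (z≢x refl)
∈-─ (here refl) (there z∈xs) _   = z∈xs
∈-─ (there _)   (here refl)  _   = here refl
∈-─ (there x∈xs) (there z∈xs) z≢x = there (∈-─ x∈xs z∈xs z≢x)

sum-mono-⊆ : ∀ {xs ys} → Unique xs → (∀ {z} → z ∈ xs → z ∈ ys) → sum xs ≤ sum ys
sum-mono-⊆ {[]}     _ _ = z≤n
sum-mono-⊆ {x ∷ xs} {ys} (x∉xs ∷ xs!) xs⊆ys = begin
  x + sum xs          ≤⟨ +-monoʳ-≤ x (sum-mono-⊆ xs! xs⊆ys─x) ⟩
  x + sum (ys ─ x∈ys) ≡⟨ sum-─ x∈ys ⟨
  sum ys              ∎
  where
  open ≤-Reasoning
  x∈ys : x ∈ ys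
  x∈ys = xs⊆ys (here refl)
  xs⊆ys─x : ∀ {z} → z ∈ xs → z ∈ (ys ─ x∈ys)
  xs⊆ys─x z∈xs = ∈-─ x∈ys (xs⊆ys (there z∈xs)) (λ z≡x → All.lookup x∉xs z∈xs (sym z≡x))

∈⇒≤sum : ∀ {x xs} → x ∈ xs → x ≤ sum xs
∈⇒≤sum {x} x∈xs = subst (x ≤_) (sym (sum-─ x∈xs)) (m≤m+n x _)

unique-map⁺-local : ∀ {a b} {A : Set a} {B : Set b} {f : A → B} {xs} →
                    (∀ {x y} → x ∈ xs → y ∈ xs → f x ≡ f y → x ≡ y) → Unique xs → Unique (map f xs)
unique-map⁺-local {xs = []}     _   []            = []
unique-map⁺-local {xs = x ∷ xs} inj (x∉xs ∷ xs!) =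
  All.map⁺ (All.tabulate λ y∈xs fx≡fy → All.lookup x∉xs y∈xs (inj (here refl) (there y∈xs) fx≡fy))
  ∷ unique-map⁺-local (λ x∈ y∈ → inj (there x∈) (there y∈)) xs!

module _ {a} {A : Set a} where

  length-filter-∁ : ∀ {ℓ} {P : Pred A ℓ} (P? : Decidable P) xs →
                    length (filter P? xs) + length (filter (∁? P?) xs) ≡ length xs
  length-filter-∁ P? []       = refl
  length-filter-∁ P? (x ∷ xs) with P? x
  ... | yes _ = cong suc (length-filter-∁ P? xs)
  ... | no  _ = trans (+-suc _ _) (cong suc (length-filter-∁ P? xs))

  length-filter-split : ∀ {ℓ ℓ′} {P : Pred A ℓ} {Q : Pred A ℓ′} (P? : Decidable P) (Q? : Decidable Q) xs →
                        length (filter P? xs) ≤ length (filter Q? xs) + length (filter (P? ∩? ∁? Q?) xs)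
  length-filter-split P? Q? []       = z≤n
  length-filter-split P? Q? (x ∷ xs) with P? x | Q? x | length-filter-split P? Q? xs
  ... | yes _ | yes _ | ih = s≤s ih
  ... | yes _ | no  _ | ih = ≤-trans (s≤s ih) (≤-reflexive (sym (+-suc _ _)))
  ... | no  _ | yes _ | ih = m≤n⇒m≤1+n ih
  ... | no  _ | no  _ | ih = ih

  length-filter-cover : ∀ {i ℓ ℓ′} {I : Set i} {P : I → Pred A ℓ} {Q : Pred A ℓ′}
                        (P? : ∀ j → Decidable (P j)) (Q? : Decidable Q) js xs →
                        (∀ {x} → x ∈ xs → Q x → Any (λ j → P j x) js) →
                        length (filter Q? xs) ≤ sum (map (λ j → length (filter (P? j) xs)) js)
  length-filter-cover P? Q? []       xs cover =
    ≤-reflexive (cong length (filter-none Q? (All.tabulate λ x∈xs qx → case cover x∈xs qx of λ ())))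
  length-filter-cover {P = P} {Q = Q} P? Q? (j ∷ js) xs cover =
    ≤-trans (length-filter-split Q? (P? j) xs)
            (+-monoʳ-≤ _ (length-filter-cover P? (Q? ∩? ∁? (P? j)) js xs cover′))
    where
    cover′ : ∀ {x} → x ∈ xs → (Q ∩ ∁ (P j)) x → Any (λ k → P k x) js
    cover′ x∈xs (qx , ¬pjx) with cover x∈xs qx
    ... | here pjx  = ⊥-elim (¬pjx pjx)
    ... | there any = any

multiples : ℕ → ℕ → ℕ
multiples p N = length (filter (p ∣?_) (range1 N))

multiples-suc : ∀ p N → multiples p (suc N) ≡ multiples p N + length (filter (p ∣?_) [ suc N ])
multiples-suc p N = begin
  length (filter (p ∣?_) (range1 (suc N)))                        ≡⟨ cong (length ∘ filter (p ∣?_)) (range1-∷ʳ N) ⟩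
  length (filter (p ∣?_) (range1 N ++ [ suc N ]))                 ≡⟨ cong length (filter-++ (p ∣?_) (range1 N) [ suc N ]) ⟩
  length (filter (p ∣?_) (range1 N) ++ filter (p ∣?_) [ suc N ])  ≡⟨ length-++ (filter (p ∣?_) (range1 N)) ⟩
  multiples p N + length (filter (p ∣?_) [ suc N ])               ∎
  where open ≡-Reasoning

multiples-suc-∣ : ∀ {p N} → p ∣ suc N → multiples p (suc N) ≡ suc (multiples p N)
multiples-suc-∣ {p} {N} p∣sN = begin
  multiples p (suc N)                                ≡⟨ multiples-suc p N ⟩
  multiples p N + length (filter (p ∣?_) [ suc N ])  ≡⟨ cong (λ xs → multiples p N + length xs) (filter-accept (p ∣?_) p∣sN) ⟩
  multiples p N + 1                                  ≡⟨ +-comm (multiples p N) 1 ⟩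
  suc (multiples p N)                                ∎
  where open ≡-Reasoning

multiples-suc-∤ : ∀ {p N} → ¬ p ∣ suc N → multiples p (suc N) ≡ multiples p N
multiples-suc-∤ {p} {N} p∤sN = begin
  multiples p (suc N)                                ≡⟨ multiples-suc p N ⟩
  multiples p N + length (filter (p ∣?_) [ suc N ])  ≡⟨ cong (λ xs → multiples p N + length xs) (filter-reject (p ∣?_) p∤sN) ⟩
  multiples p N + 0                                  ≡⟨ +-identityʳ (multiples p N) ⟩
  multiples p N                                      ∎
  where open ≡-Reasoning

multiples-bounds : ∀ p N → 1 ≤ p → multiples p N * p ≤ N × N < suc (multiples p N) * p
multiples-bounds p zero    1≤p = z≤n , ≤-trans 1≤p (≤-reflexive (sym (+-identityʳ p)))
multiples-bounds p (suc N) 1≤p with multiples-bounds p N 1≤p | p ∣? suc N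
... | lower , upper | yes p∣sN@(divides j sN≡jp) rewrite multiples-suc-∣ p∣sN =
  ≤-reflexive (sym sN≡q+1p) , subst (_< suc (suc q) * p) (sym sN≡q+1p) (m<n+m (suc q * p) 1≤p)
  where
  q : ℕ
  q = multiples p N
  q<j : q < j
  q<j = *-cancelʳ-< p q j (subst (q * p <_) sN≡jp (s≤s lower))
  sN≡q+1p : suc N ≡ suc q * p
  sN≡q+1p = ≤-antisym upper (subst (suc q * p ≤_) (sym sN≡jp) (*-monoˡ-≤ p q<j))
... | lower , upper | no p∤sN rewrite multiples-suc-∤ p∤sN =
  m≤n⇒m≤1+n lower , ≤∧≢⇒< upper (λ sN≡q+1p → p∤sN (divides (suc (multiples p N)) sN≡q+1p))

multiples-* : ∀ p q → 1 ≤ p → multiples p (q * p) ≡ q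
multiples-* p@(suc _) q 1≤p with multiples-bounds p (q * p) 1≤p
... | lower , upper = ≤-antisym (*-cancelʳ-≤ _ q p lower) (s≤s⁻¹ (*-cancelʳ-< p q _ upper))

∣⇒≥1 : ∀ {d n} → 1 ≤ n → d ∣ n → 1 ≤ d
∣⇒≥1 1≤n d∣n = n≢0⇒n>0 λ { refl → n≮n 0 (subst (0 <_) (0∣⇒≡0 d∣n) 1≤n) }

multiples-cofactor : ∀ {d n} → 1 ≤ n → d ∣ n → multiples d n * d ≡ n
multiples-cofactor {d} 1≤n (divides q refl) = cong (_* d) (multiples-* d q (∣⇒≥1 1≤n (n∣m*n q)))

multiples-cofactor-∣ : ∀ {d n} → 1 ≤ n → d ∣ n → multiples d n ∣ n
multiples-cofactor-∣ {d} 1≤n d∣n = divides d (sym (trans (*-comm d _) (multiples-cofactor 1≤n d∣n)))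

multiples-cofactor-injective : ∀ {d d′ n} → 1 ≤ n → d ∣ n → d′ ∣ n → multiples d n ≡ multiples d′ n → d ≡ d′
multiples-cofactor-injective {d} {d′} {n} 1≤n d∣n d′∣n eq =
  *-cancelˡ-≡ d d′ (multiples d n) {{>-nonZero (∣⇒≥1 1≤n (multiples-cofactor-∣ 1≤n d∣n))}} (begin
    multiples d n * d    ≡⟨ multiples-cofactor 1≤n d∣n ⟩
    n                    ≡⟨ multiples-cofactor 1≤n d′∣n ⟨
    multiples d′ n * d′  ≡⟨ cong (_* d′) eq ⟨
    multiples d n * d′   ∎)
  where open ≡-Reasoning

prime⇒≥2 : ∀ {p} → Prime p → 2 ≤ p
prime⇒≥2 {p} p-prime = nonTrivial⇒n>1 p {{prime⇒nonTrivial p-prime}}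

∃-prime-∣ : ∀ n → 2 ≤ n → ∃[ p ] Prime p × p ∣ n
∃-prime-∣ 1 (s≤s ())
∃-prime-∣ n@(suc (suc _)) _ with factorise n
... | record { factors = [] ; isFactorisation = () }
... | record { factors = p ∷ ps ; isFactorisation = n≡∏ ; factorsPrime = p-prime ∷ _ } =
  p , p-prime , subst (p ∣_) (sym n≡∏) (m∣m*n (product ps))

prime∣prime⇒≡ : ∀ {p q} → Prime p → Prime q → p ∣ q → p ≡ q
prime∣prime⇒≡ p-prime q-prime p∣q with prime⇒irreducible q-prime p∣q
... | inj₁ refl = contradiction p-prime ¬prime[1]
... | inj₂ p≡q  = p≡q

prime∣prime^⇒≡ : ∀ {p q} k → Prime p → Prime q → p ∣ q ^ k → p ≡ q
prime∣prime^⇒≡ zero    p-prime _       p∣1 = contradiction (subst Prime (∣1⇒≡1 p∣1) p-prime) ¬prime[1]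
prime∣prime^⇒≡ {q = q} (suc k) p-prime q-prime p∣q^k+1 with euclidsLemma q (q ^ k) p-prime p∣q^k+1
... | inj₁ p∣q   = prime∣prime⇒≡ p-prime q-prime p∣q
... | inj₂ p∣q^k = prime∣prime^⇒≡ k p-prime q-prime p∣q^k

-- Peel one factor q off m at a time: q ∤ p ^ a, so Euclid puts it in m.
prime^∣prime^*⇒∣ : ∀ {p q} a b m → Prime p → Prime q → q ≢ p → q ^ b ∣ p ^ a * m → q ^ b ∣ m
prime^∣prime^*⇒∣         a zero    m _       _       _   _ = 1∣ m
prime^∣prime^*⇒∣ {p} {q} a (suc b) m p-prime q-prime q≢p q^b+1∣p^am
  with euclidsLemma (p ^ a) m q-prime (∣-trans (m∣m*n (q ^ b)) q^b+1∣p^am)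
... | inj₁ q∣p^a = contradiction (prime∣prime^⇒≡ a q-prime p-prime q∣p^a) q≢p
... | inj₂ (divides m′ m≡m′q) = subst (q ^ suc b ∣_) (trans (*-comm q m′) (sym m≡m′q)) (*-monoʳ-∣ q q^b∣m′)
  where
  instance _ = prime⇒nonZero q-prime
  q^b∣m′ : q ^ b ∣ m′
  q^b∣m′ = prime^∣prime^*⇒∣ a b m′ p-prime q-prime q≢p
             (*-cancelˡ-∣ q (subst (q ^ suc b ∣_) (trans (cong (p ^ a *_) m≡m′q) (*-Props.x∙yz≈z∙xy (p ^ a) m′ q)) q^b+1∣p^am))

^-monoʳ-∣ : ∀ p {b c} → b ≤ c → p ^ b ∣ p ^ c
^-monoʳ-∣ p {b} b≤c with m≤n⇒∃[o]m+o≡n b≤c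
... | k , refl = divides (p ^ k) (trans (^-distribˡ-+-* p b k) (*-comm (p ^ b) (p ^ k)))

n<m^n : ∀ m n → 2 ≤ m → n < m ^ n
n<m^n m zero    _   = s≤s z≤n
n<m^n m (suc n) 2≤m = begin-strict
  suc n          ≤⟨ n<m^n m n 2≤m ⟩
  m ^ n          <⟨ m<m*n (m ^ n) m {{m^n≢0 m n {{>-nonZero (≤-trans (s≤s z≤n) 2≤m)}}}} 2≤m ⟩
  m ^ n * m      ≡⟨ *-comm (m ^ n) m ⟩
  m * m ^ n      ∎
  where open ≤-Reasoning

∈-primeDivisors⁻ : ∀ {n p} → p ∈ primeDivisors n → Prime p × p ∣ n
∈-primeDivisors⁻ {n} p∈ with ∈-filter⁻ (_∣? n) {xs = filter prime? (range1 n)} p∈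
... | p∈primes , p∣n = proj₂ (∈-filter⁻ prime? {xs = range1 n} p∈primes) , p∣n

∈-primeDivisors⁺ : ∀ {n p} → 1 ≤ n → Prime p → p ∣ n → p ∈ primeDivisors n
∈-primeDivisors⁺ {n} 1≤n p-prime p∣n =
  ∈-filter⁺ (_∣? n) (∈-filter⁺ prime? (∈-range1⁺ (≤-trans (s≤s z≤n) (prime⇒≥2 p-prime)) (∣⇒≤ {{>-nonZero 1≤n}} p∣n)) p-prime) p∣n

primeDivisors-unique : ∀ n → Unique (primeDivisors n)
primeDivisors-unique n = Unique.filter⁺ (_∣? n) (Unique.filter⁺ prime? (range1-unique n))

module _ {ℓ} {P : Pred ℕ ℓ} (P? : Decidable P) where

  lastWitnessStep : ℕ → ℕ → ℕ
  lastWitnessStep a acc = if does (acc ≟ 0) then (if does (P? a) then a else 0) else acc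

  -- The accumulator stays put once nonzero, so the fold returns the last nonzero witness of P.
  lastWitness : List ℕ → ℕ
  lastWitness = foldr lastWitnessStep 0

  foldr-lastWitnessStep-suc : ∀ k xs → foldr lastWitnessStep (suc k) xs ≡ suc k
  foldr-lastWitnessStep-suc k []       = refl
  foldr-lastWitnessStep-suc k (x ∷ xs) rewrite foldr-lastWitnessStep-suc k xs = refl

  lastWitnessStep-accept : ∀ {a} → P a → lastWitnessStep a 0 ≡ a
  lastWitnessStep-accept {a} Pa with P? a
  ... | yes _  = refl
  ... | no ¬Pa = contradiction Pa ¬Pa

  lastWitnessStep-reject : ∀ {a} → ¬ P a → lastWitnessStep a 0 ≡ 0
  lastWitnessStep-reject {a} ¬Pa with P? a
  ... | yes Pa = contradiction Pa ¬Pa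
  ... | no _   = refl

  lastWitness-range1-suc-accept : ∀ m → P (suc m) → lastWitness (range1 (suc m)) ≡ suc m
  lastWitness-range1-suc-accept m Psm = begin
    lastWitness (range1 (suc m))                                 ≡⟨ cong lastWitness (range1-∷ʳ m) ⟩
    lastWitness (range1 m ++ [ suc m ])                          ≡⟨ foldr-++ lastWitnessStep 0 (range1 m) [ suc m ] ⟩
    foldr lastWitnessStep (lastWitnessStep (suc m) 0) (range1 m) ≡⟨ cong (λ acc → foldr lastWitnessStep acc (range1 m)) (lastWitnessStep-accept Psm) ⟩
    foldr lastWitnessStep (suc m) (range1 m)                     ≡⟨ foldr-lastWitnessStep-suc m (range1 m) ⟩
    suc m                                                        ∎
    where open ≡-Reasoning

  lastWitness-range1-suc-reject : ∀ m → ¬ P (suc m) → lastWitness (range1 (suc m)) ≡ lastWitness (range1 m)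
  lastWitness-range1-suc-reject m ¬Psm = begin
    lastWitness (range1 (suc m))                                 ≡⟨ cong lastWitness (range1-∷ʳ m) ⟩
    lastWitness (range1 m ++ [ suc m ])                          ≡⟨ foldr-++ lastWitnessStep 0 (range1 m) [ suc m ] ⟩
    foldr lastWitnessStep (lastWitnessStep (suc m) 0) (range1 m) ≡⟨ cong (λ acc → foldr lastWitnessStep acc (range1 m)) (lastWitnessStep-reject ¬Psm) ⟩
    lastWitness (range1 m)                                       ∎
    where open ≡-Reasoning

  lastWitness-range1-satisfies : P 0 → ∀ m → P (lastWitness (range1 m))
  lastWitness-range1-satisfies P0 zero    = P0
  lastWitness-range1-satisfies P0 (suc m) with P? (suc m)
  ... | yes Psm = subst P (sym (lastWitness-range1-suc-accept m Psm)) Psm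
  ... | no ¬Psm = subst P (sym (lastWitness-range1-suc-reject m ¬Psm)) (lastWitness-range1-satisfies P0 m)

  lastWitness-range1-maximal : ∀ m b → b ≤ m → P b → b ≤ lastWitness (range1 m)
  lastWitness-range1-maximal zero    b b≤0  _  = b≤0
  lastWitness-range1-maximal (suc m) b b≤sm Pb with P? (suc m)
  ... | yes Psm = subst (b ≤_) (sym (lastWitness-range1-suc-accept m Psm)) b≤sm
  ... | no ¬Psm = subst (b ≤_) (sym (lastWitness-range1-suc-reject m ¬Psm)) b≤lw
    where
    b≤lw : b ≤ lastWitness (range1 m)
    b≤lw with m≤n⇒m<n∨m≡n b≤sm
    ... | inj₁ b<sm = lastWitness-range1-maximal m b (s≤s⁻¹ b<sm) Pb
    ... | inj₂ refl = contradiction Pb ¬Psm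

val-lastWitness : ∀ p n → val p n ≡ lastWitness (λ a → p ^ a ∣? n) (range1 n)
val-lastWitness p n = refl

val-∣ : ∀ p n → p ^ val p n ∣ n
val-∣ p n = subst (λ v → p ^ v ∣ n) (sym (val-lastWitness p n))
              (lastWitness-range1-satisfies (λ a → p ^ a ∣? n) (1∣ n) n)

-- The bound n on the exponents searched by val is harmless since a < p ^ a.
val-∤ : ∀ {p n} → 2 ≤ p → 1 ≤ n → ¬ p ^ suc (val p n) ∣ n
val-∤ {p} {n} 2≤p 1≤n p^v+1∣n = n≮n (val p n) (lastWitness-range1-maximal (λ a → p ^ a ∣? n) n (suc (val p n)) v+1≤n p^v+1∣n)
  where
  v+1≤n : suc (val p n) ≤ n
  v+1≤n = ≤-trans (<⇒≤ (n<m^n p (suc (val p n)) 2≤p)) (∣⇒≤ {{>-nonZero 1≤n}} p^v+1∣n)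

val-unique : ∀ {p n a} → 2 ≤ p → 1 ≤ n → p ^ a ∣ n → ¬ p ^ suc a ∣ n → val p n ≡ a
val-unique {p} {n} {a} 2≤p 1≤n p^a∣n p^a+1∤n = ≤-antisym
  (≮⇒≥ λ a<v → p^a+1∤n (∣-trans (^-monoʳ-∣ p a<v) (val-∣ p n)))
  (≮⇒≥ λ v<a → val-∤ 2≤p 1≤n (∣-trans (^-monoʳ-∣ p v<a) p^a∣n))

primePowerProduct : (ℕ → ℕ) → List ℕ → ℕ
primePowerProduct e ps = product (map (λ p → p ^ e p) ps)

primePowerProduct-val : ∀ ps n → 1 ≤ n → All Prime ps → Unique ps →
                        (∀ {q} → Prime q → q ∣ n → q ∈ ps) →
                        n ≡ primePowerProduct (λ p → val p n) ps
primePowerProduct-val [] n 1≤n [] [] ps-complete with n ≟ 1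
... | yes n≡1 = n≡1
... | no  n≢1 with ∃-prime-∣ n (≤∧≢⇒< 1≤n (≢-sym n≢1))
...   | q , q-prime , q∣n with () ← ps-complete q-prime q∣n
primePowerProduct-val (p ∷ ps) n 1≤n (p-prime ∷ ps-prime) (p∉ps ∷ ps!) ps-complete
  with val-∣ p n
... | divides m n≡mp^a = begin
  n                                                ≡⟨ n≡mp^a ⟩
  m * p ^ a                                        ≡⟨ *-comm m (p ^ a) ⟩
  p ^ a * m                                        ≡⟨ cong (p ^ a *_) (primePowerProduct-val ps m 1≤m ps-prime ps! ps-complete′) ⟩
  p ^ a * primePowerProduct (λ q → val q m) ps     ≡⟨ cong (λ qs → p ^ a * product qs) (map-cong-local (All.tabulate val-m≡val-n)) ⟩
  p ^ a * primePowerProduct (λ q → val q n) ps     ∎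
  where
  open ≡-Reasoning
  a : ℕ
  a = val p n
  2≤p : 2 ≤ p
  2≤p = prime⇒≥2 p-prime
  n≡p^am : n ≡ p ^ a * m
  n≡p^am = trans n≡mp^a (*-comm m (p ^ a))
  m∣n : m ∣ n
  m∣n = divides (p ^ a) n≡p^am
  1≤m : 1 ≤ m
  1≤m = n≢0⇒n>0 λ { refl → n≮n 0 (subst (0 <_) n≡mp^a 1≤n) }
  ps-complete′ : ∀ {q} → Prime q → q ∣ m → q ∈ ps
  ps-complete′ q-prime q∣m with ps-complete q-prime (∣-trans q∣m m∣n)
  ... | here refl = contradiction (subst (p * p ^ a ∣_) (sym n≡mp^a) (*-monoˡ-∣ (p ^ a) q∣m)) (val-∤ 2≤p 1≤n)
  ... | there q∈ps = q∈ps
  val-m≡val-n : ∀ {q} → q ∈ ps → q ^ val q m ≡ q ^ val q n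
  val-m≡val-n {q} q∈ps = cong (q ^_) (sym (val-unique {a = val q m} (prime⇒≥2 q-prime) 1≤n
    (∣-trans (val-∣ q m) m∣n)
    (λ q^b+1∣n → val-∤ (prime⇒≥2 q-prime) 1≤m
       (prime^∣prime^*⇒∣ a (suc (val q m)) m p-prime q-prime q≢p (subst (q ^ suc (val q m) ∣_) n≡p^am q^b+1∣n)))))
    where
    q-prime : Prime q
    q-prime = All.lookup ps-prime q∈ps
    q≢p : q ≢ p
    q≢p q≡p = All.lookup p∉ps q∈ps (sym q≡p)

dedekindProduct : (ℕ → ℕ) → List ℕ → ℕ
dedekindProduct e ps = product (map (λ p → p ^ (e p ∸ 1) * (p + 1)) ps)

cofactorSum : List ℕ → ℕ → ℕ
cofactorSum ps N = sum (map (λ p → multiples p N) ps)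

-- This is ∏ (1 + 1/p) ≥ 1 + Σ 1/p, scaled by N = c · ∏ p ^ e p.
dedekindProduct-lower : ∀ e ps → All (λ p → 1 ≤ p × 1 ≤ e p) ps → ∀ c N →
                        N ≡ c * primePowerProduct e ps → N + cofactorSum ps N ≤ c * dedekindProduct e ps
dedekindProduct-lower e []       []                   c N N≡c*1 = ≤-reflexive (trans (+-identityʳ N) N≡c*1)
dedekindProduct-lower e (p ∷ ps) ((1≤p , 1≤ep) ∷ hyp) c N N≡cX with e p | 1≤ep
... | suc k | _ = begin
  N + (multiples p N + cofactorSum ps N)  ≡⟨ cong (λ j → N + (j + cofactorSum ps N)) multiples-p-N ⟩
  N + (c * y * X + cofactorSum ps N)      ≡⟨ x∙yz≈y∙xz N (c * y * X) _ ⟩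
  c * y * X + (N + cofactorSum ps N)      ≤⟨ +-mono-≤ (*-monoʳ-≤ (c * y) X≤Ψ) ih ⟩
  c * y * Ψ + c * (p * y) * Ψ             ≡⟨ collect c p y Ψ ⟩
  c * (y * (p + 1) * Ψ)                   ∎
  where
  open ≤-Reasoning
  pull-out : ∀ c p y X → c * (p * y * X) ≡ c * y * X * p
  pull-out = solve-∀
  collect : ∀ c p y Ψ → c * y * Ψ + c * (p * y) * Ψ ≡ c * (y * (p + 1) * Ψ)
  collect = solve-∀
  y X Ψ : ℕ
  y = p ^ k
  X = primePowerProduct e ps
  Ψ = dedekindProduct e ps
  multiples-p-N : multiples p N ≡ c * y * X
  multiples-p-N = trans (cong (multiples p) (trans N≡cX (pull-out c p y X))) (multiples-* p (c * y * X) 1≤p)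
  ih : N + cofactorSum ps N ≤ c * (p * y) * Ψ
  ih = dedekindProduct-lower e ps hyp (c * (p * y)) N (trans N≡cX (sym (*-assoc c (p * y) X)))
  X≤Ψ : X ≤ Ψ
  X≤Ψ = subst₂ _≤_ (*-identityˡ X) (*-identityˡ Ψ)
          (≤-trans (m≤m+n (1 * X) _) (dedekindProduct-lower e ps hyp 1 (1 * X) refl))

primeCofactorSum : ℕ → ℕ
primeCofactorSum n = cofactorSum (primeDivisors n) n

-- n itself is the cofactor of the divisor 1.
σ-lower : ∀ n → 1 ≤ n → n + primeCofactorSum n ≤ σ n
σ-lower n 1≤n = subst (λ m → m + primeCofactorSum n ≤ σ n) multiples-1
                  (sum-mono-⊆ (unique-map⁺-local cofactor-injective divisors-unique) cofactor∈divisors)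
  where
  multiples-1 : multiples 1 n ≡ n
  multiples-1 = trans (cong (multiples 1) (sym (*-identityʳ n))) (multiples-* 1 n ≤-refl)
  divisors-∣ : ∀ {d} → d ∈ 1 ∷ primeDivisors n → d ∣ n
  divisors-∣ (here refl) = 1∣ n
  divisors-∣ (there p∈)  = proj₂ (∈-primeDivisors⁻ {n} p∈)
  divisors-unique : Unique (1 ∷ primeDivisors n)
  divisors-unique = All.tabulate (λ p∈ 1≡p → ¬prime[1] (subst Prime (sym 1≡p) (proj₁ (∈-primeDivisors⁻ {n} p∈))))
                    ∷ primeDivisors-unique n
  cofactor-injective : ∀ {d d′} → d ∈ 1 ∷ primeDivisors n → d′ ∈ 1 ∷ primeDivisors n →
                       multiples d n ≡ multiples d′ n → d ≡ d′
  cofactor-injective d∈ d′∈ = multiples-cofactor-injective 1≤n (divisors-∣ d∈) (divisors-∣ d′∈)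
  cofactor∈divisors : ∀ {m} → m ∈ map (λ d → multiples d n) (1 ∷ primeDivisors n) → m ∈ filter (_∣? n) (range1 n)
  cofactor∈divisors m∈ with ∈-map⁻ (λ d → multiples d n) m∈
  ... | d , d∈ , refl = ∈-filter⁺ (_∣? n)
        (∈-range1⁺ (∣⇒≥1 1≤n cofactor∣n) (∣⇒≤ {{>-nonZero 1≤n}} cofactor∣n)) cofactor∣n
    where
    cofactor∣n : multiples d n ∣ n
    cofactor∣n = multiples-cofactor-∣ 1≤n (divisors-∣ d∈)

val-≥1 : ∀ {p n} → 2 ≤ p → 1 ≤ n → p ∣ n → 1 ≤ val p n
val-≥1 {p} {n} 2≤p 1≤n p∣n = n≢0⇒n>0 λ v≡0 →
  val-∤ 2≤p 1≤n (subst (λ v → p ^ suc v ∣ n) (sym v≡0) (subst (_∣ n) (sym (*-identityʳ p)) p∣n))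

ψ-lower : ∀ n → 1 ≤ n → n + primeCofactorSum n ≤ ψ n
ψ-lower n 1≤n = subst (n + primeCofactorSum n ≤_) (*-identityˡ (ψ n))
  (dedekindProduct-lower (λ p → val p n) (primeDivisors n) exponents-positive 1 n
    (trans n≡∏p^val (sym (*-identityˡ _))))
  where
  exponents-positive : All (λ p → 1 ≤ p × 1 ≤ val p n) (primeDivisors n)
  exponents-positive = All.tabulate λ p∈ →
    let p-prime , p∣n = ∈-primeDivisors⁻ {n} p∈
    in ≤-trans (s≤s z≤n) (prime⇒≥2 p-prime) , val-≥1 (prime⇒≥2 p-prime) 1≤n p∣n
  n≡∏p^val : n ≡ primePowerProduct (λ p → val p n) (primeDivisors n)
  n≡∏p^val = primePowerProduct-val (primeDivisors n) n 1≤n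
    (All.tabulate (λ p∈ → proj₁ (∈-primeDivisors⁻ {n} p∈))) (primeDivisors-unique n) (∈-primeDivisors⁺ 1≤n)

¬coprime⇒common-prime-divisor : ∀ {m n} → 1 ≤ n → ¬ Coprime m n → ∃[ p ] Prime p × p ∣ m × p ∣ n
¬coprime⇒common-prime-divisor {m} {n} 1≤n ¬coprime with ∃-prime-∣ (gcd m n) 2≤gcd
  where
  2≤gcd : 2 ≤ gcd m n
  2≤gcd = ≤∧≢⇒< (∣⇒≥1 1≤n (gcd[m,n]∣n m n)) (λ 1≡gcd → ¬coprime (gcd≡1⇒coprime (sym 1≡gcd)))
... | p , p-prime , p∣gcd = p , p-prime , ∣-trans p∣gcd (gcd[m,n]∣m m n) , ∣-trans p∣gcd (gcd[m,n]∣n m n)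

φ-lower : ∀ n → 1 ≤ n → n ≤ φ n + primeCofactorSum n
φ-lower n 1≤n = begin
  n                                                  ≡⟨ length-range1 n ⟨
  length (range1 n)                                  ≡⟨ length-filter-∁ coprimeTo? (range1 n) ⟨
  φ n + length (filter (∁? coprimeTo?) (range1 n))   ≤⟨ +-monoʳ-≤ (φ n) non-coprime-count ⟩
  φ n + primeCofactorSum n                           ∎
  where
  open ≤-Reasoning
  coprimeTo? : Decidable (λ k → Coprime k n)
  coprimeTo? k = coprime? k n
  cover : ∀ {k} → k ∈ range1 n → ¬ Coprime k n → Any (_∣ k) (primeDivisors n)
  cover _ ¬coprime with ¬coprime⇒common-prime-divisor 1≤n ¬coprime
  ... | p , p-prime , p∣k , p∣n = Any.map (λ { refl → p∣k }) (∈-primeDivisors⁺ 1≤n p-prime p∣n)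
  non-coprime-count : length (filter (∁? coprimeTo?) (range1 n)) ≤ primeCofactorSum n
  non-coprime-count = length-filter-cover _∣?_ (∁? coprimeTo?) (primeDivisors n) (range1 n) cover

primeCofactorSum-≥1 : ∀ n → 2 ≤ n → 1 ≤ primeCofactorSum n
primeCofactorSum-≥1 n 2≤n with ∃-prime-∣ n 2≤n
... | p , p-prime , p∣n = ≤-trans (∣⇒≥1 1≤n (multiples-cofactor-∣ 1≤n p∣n))
                            (∈⇒≤sum (∈-map⁺ (λ p → multiples p n) (∈-primeDivisors⁺ 1≤n p-prime p∣n)))
  where
  1≤n : 1 ≤ n
  1≤n = ≤-trans (s≤s z≤n) 2≤n

quartic : ℕ → ℕ → ℕ
quartic n R = 3 * n ^ 4 + 4 * n ^ 3 * R + 2 * n ^ 2 * R ^ 2 + 4 * n * R ^ 3 + 3 * R ^ 4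

quartic-1 : ∀ n → quartic n 1 ≡ 3 * n ^ 4 + 4 * n ^ 3 + 2 * n ^ 2 + 4 * n + 3
quartic-1 = solve 1 (λ n → con 3 :* n :^ 4 :+ con 4 :* n :^ 3 :* con 1 :+ con 2 :* n :^ 2 :* con 1 :^ 2
                           :+ con 4 :* n :* con 1 :^ 3 :+ con 3 :* con 1 :^ 4
                        := con 3 :* n :^ 4 :+ con 4 :* n :^ 3 :+ con 2 :* n :^ 2 :+ con 4 :* n :+ con 3) refl

quartic-monoʳ-≤ : ∀ n {R R′} → R ≤ R′ → quartic n R ≤ quartic n R′
quartic-monoʳ-≤ n R≤R′ =
  +-mono-≤ (+-mono-≤ (+-mono-≤ (+-monoʳ-≤ (3 * n ^ 4) (*-monoʳ-≤ (4 * n ^ 3) R≤R′))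
                               (*-monoʳ-≤ (2 * n ^ 2) (^-monoˡ-≤ 2 R≤R′)))
                     (*-monoʳ-≤ (4 * n) (^-monoˡ-≤ 3 R≤R′)))
           (*-monoʳ-≤ 3 (^-monoˡ-≤ 4 R≤R′))

quartic-≤-split : ∀ R d → quartic (R + d) R ≡ d ^ 2 * (R + d + R) ^ 2 + d ^ 2 * (R + d + R) ^ 2 + (R + d + R) ^ 2 * (R + d + R) ^ 2
quartic-≤-split = solve 2 (λ R d → con 3 :* (R :+ d) :^ 4 :+ con 4 :* (R :+ d) :^ 3 :* R :+ con 2 :* (R :+ d) :^ 2 :* R :^ 2
                                    :+ con 4 :* (R :+ d) :* R :^ 3 :+ con 3 :* R :^ 4
                                 := d :^ 2 :* (R :+ d :+ R) :^ 2 :+ d :^ 2 :* (R :+ d :+ R) :^ 2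
                                    :+ (R :+ d :+ R) :^ 2 :* (R :+ d :+ R) :^ 2) refl

quartic-diagonal : ∀ n → quartic n n ≡ (n + n) ^ 2 * (n + n) ^ 2
quartic-diagonal = solve 1 (λ n → con 3 :* n :^ 4 :+ con 4 :* n :^ 3 :* n :+ con 2 :* n :^ 2 :* n :^ 2 :+ con 4 :* n :* n :^ 3
                                  :+ con 3 :* n :^ 4 := (n :+ n) :^ 2 :* (n :+ n) :^ 2) refl

quartic-bound : ∀ n R t s u → 1 ≤ n → 1 ≤ R → n ≤ t + R → n + R ≤ s → n + R ≤ u →
                3 * n ^ 4 + 4 * n ^ 3 + 2 * n ^ 2 + 4 * n + 3 ≤ t ^ 2 * u ^ 2 + t ^ 2 * s ^ 2 + s ^ 2 * u ^ 2
quartic-bound n R t s u 1≤n 1≤R n≤t+R w≤s w≤u = begin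
  3 * n ^ 4 + 4 * n ^ 3 + 2 * n ^ 2 + 4 * n + 3  ≡⟨ quartic-1 n ⟨
  quartic n 1                                    ≤⟨ quartic-monoʳ-≤ n (⊓-glb 1≤n 1≤R) ⟩
  quartic n (n ⊓ R)                              ≤⟨ bound (≤-total R n) ⟩
  t ^ 2 * u ^ 2 + t ^ 2 * s ^ 2 + s ^ 2 * u ^ 2  ∎
  where
  open ≤-Reasoning
  sq : ∀ {a b} → a ≤ b → a ^ 2 ≤ b ^ 2
  sq = ^-monoˡ-≤ 2
  bound : R ≤ n ⊎ n ≤ R → quartic n (n ⊓ R) ≤ t ^ 2 * u ^ 2 + t ^ 2 * s ^ 2 + s ^ 2 * u ^ 2
  bound (inj₁ R≤n) with m≤n⇒∃[o]m+o≡n R≤n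
  ... | d , refl rewrite m≥n⇒m⊓n≡n R≤n = begin
    quartic (R + d) R                              ≡⟨ quartic-≤-split R d ⟩
    d ^ 2 * w ^ 2 + d ^ 2 * w ^ 2 + w ^ 2 * w ^ 2  ≤⟨ +-mono-≤ (+-mono-≤ (*-mono-≤ d²≤t² (sq w≤u)) (*-mono-≤ d²≤t² (sq w≤s)))
                                                               (*-mono-≤ (sq w≤s) (sq w≤u)) ⟩
    t ^ 2 * u ^ 2 + t ^ 2 * s ^ 2 + s ^ 2 * u ^ 2  ∎
    where
    w : ℕ
    w = R + d + R
    d²≤t² : d ^ 2 ≤ t ^ 2
    d²≤t² = sq (+-cancelˡ-≤ R d t (subst (R + d ≤_) (+-comm t R) n≤t+R))
  bound (inj₂ n≤R) rewrite m≤n⇒m⊓n≡m n≤R = begin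
    quartic n n                                    ≡⟨ quartic-diagonal n ⟩
    (n + n) ^ 2 * (n + n) ^ 2                      ≤⟨ *-mono-≤ (sq (≤-trans 2n≤w w≤s)) (sq (≤-trans 2n≤w w≤u)) ⟩
    s ^ 2 * u ^ 2                                  ≤⟨ m≤n+m _ _ ⟩
    t ^ 2 * u ^ 2 + t ^ 2 * s ^ 2 + s ^ 2 * u ^ 2  ∎
    where
    2n≤w : n + n ≤ n + R
    2n≤w = +-monoʳ-≤ n n≤R

theorem3 : (n : ℕ) → 2 ≤ n →
    3 * n ^ 4 + 4 * n ^ 3 + 2 * n ^ 2 + 4 * n + 3
      ≤ φ n ^ 2 * ψ n ^ 2 + φ n ^ 2 * σ n ^ 2 + σ n ^ 2 * ψ n ^ 2
theorem3 n 2≤n = quartic-bound n (primeCofactorSum n) (φ n) (σ n) (ψ n) 1≤n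
  (primeCofactorSum-≥1 n 2≤n) (φ-lower n 1≤n) (σ-lower n 1≤n) (ψ-lower n 1≤n)
  where
  1≤n : 1 ≤ n
  1≤n = ≤-trans (s≤s z≤n) 2≤n
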